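{- Given a problem instance that admits a feasible schedule, algorithm Parallel Left-to-Right (PLTR) constructs a feasible schedule.
   Context: Problem: $m\ge1$ processors numbered $1,\dots,m$; a set $J$ of jobs, each with integer release time $r_j$, deadline $d_j$, processing volume $p_j$; time slots $T=\{0,\dots,d\}$ ($d$ the latest deadline, earliest release $0$); $E_j=\{t\in T: r_j\le t\le d_j\}$. A feasible schedule assigns to each processor and slot at most one job such that every job $j$ occupies exactly $p_j$ distinct slots of $E_j$ and is never on two processors in the same slot. For bounds $0 \le l_t \le m_t \le m$ ($t\in T$), the instance of deadline-scheduling-with-processor-bounds is feasible if some feasible schedule has $l_t\le \mathrm{vol}(t)\le m_t$ for all $t$, where $\mathrm{vol}(t)$ is the number of busy processors at $t$. Algorithm PLTR: initialize $m_t \gets m$, $l_t \gets 0$ for all $t\in T$. For $k = m, m-1, \dots, 1$: set $t\gets 0$; while $t \le d$: $t \gets \mathrm{KeepIdle}(k,t)$; $t \gets \mathrm{KeepBusy}(k,t)$. Here $\mathrm{KeepIdle}(k,t)$ finds the maximal $t' > t$ such that the bounds instance remains feasible when $m_{t''}$ is set to $k-1$ for all $t''\in[t,t')$, performs this update, and returns $t'$; $\mathrm{KeepBusy}(k,t)$ finds the maximal $t'>t$ such that the bounds instance remains feasible when $l_{t''}$ is set to $\max\{k,l_{t''}\}$ for all $t''\in[t,t')$, performs this update, and returns $t'$. Feasibility is checked by a maximum flow computation. Finally PLTR outputs a feasible schedule respecting the final bounds $l_t, m_t$, obtained from a maximum flow, in which the jobs scheduled at each slot are placed on the lowest-numbered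 processors. -}

module Defs where

open import Data.Nat using (ℕ; zero; suc; _+_; _≤_; _<_; _⊔_; _≤ᵇ_; _<ᵇ_)
open import Data.Bool using (Bool; true; false; if_then_else_; _∧_)
open import Data.Fin using (Fin; toℕ; _≟_)
open import Data.Maybe using (Maybe; just; nothing; is-just)
open import Data.List using (List; upTo; allFin; map)
open import Data.Bool.ListAction using (any)
open import Data.Nat.ListAction using (sum)
open import Data.Product using (Σ; _×_; _,_)
open import Relation.Binary.PropositionalEquality using (_≡_)
open import Relation.Nullary using (¬_)
open import Relation.Nullary.Decidable using (⌊_⌋)

record Job : Set where
  field
    rel : ℕ
    dl  : ℕ
    vol : ℕ

record Instance : Set where
  field
    m    : ℕ
    m≥1  : 1 ≤ m
    n    : ℕ
    job  : Fin n → Job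

maxDeadline : (n : ℕ) → (Fin n → Job) → ℕ
maxDeadline zero    f = 0
maxDeadline (suc n) f = Job.dl (f Fin.zero) ⊔ maxDeadline n (λ i → f (Fin.suc i))

-- d : the latest deadline; the time slots are T = {0, ..., d}
lastSlot : Instance → ℕ
lastSlot I = maxDeadline (Instance.n I) (Instance.job I)

Schedule : Instance → Set
Schedule I = Fin (Instance.m I) → ℕ → Maybe (Fin (Instance.n I))

isJob : {n : ℕ} → Fin n → Maybe (Fin n) → Bool
isJob j nothing   = false
isJob j (just j') = ⌊ j ≟ j' ⌋

occupied : (I : Instance) → Schedule I → Fin (Instance.n I) → ℕ → Bool
occupied I S j t = any (λ i → isJob j (S i t)) (allFin (Instance.m I))

b2n : Bool → ℕ
b2n true  = 1
b2n false = 0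

slotsOf : (I : Instance) → Schedule I → Fin (Instance.n I) → ℕ
slotsOf I S j = sum (map (λ t → b2n (occupied I S j t)) (upTo (suc (lastSlot I))))

volume : (I : Instance) → Schedule I → ℕ → ℕ
volume I S t = sum (map (λ i → b2n (is-just (S i t))) (allFin (Instance.m I)))

record FeasibleSchedule (I : Instance) (S : Schedule I) : Set where
  field
    inWindow : ∀ i t j → S i t ≡ just j →
               Job.rel (Instance.job I j) ≤ t × t ≤ Job.dl (Instance.job I j)
    noParallel : ∀ i i' t j → S i t ≡ just j → S i' t ≡ just j → i ≡ i'
    volumeOK : ∀ j → slotsOf I S j ≡ Job.vol (Instance.job I j)

Feasible : Instance → Set
Feasible I = Σ (Schedule I) (FeasibleSchedule I)

record Bounds : Set where
  constructor bounds
  field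
    lower : ℕ → ℕ
    upper : ℕ → ℕ

RespectsBounds : (I : Instance) → Bounds → Schedule I → Set
RespectsBounds I B S = ∀ t → t ≤ lastSlot I →
  Bounds.lower B t ≤ volume I S t × volume I S t ≤ Bounds.upper B t

FeasibleB : (I : Instance) → Bounds → Set
FeasibleB I B = Σ (Schedule I) (λ S → FeasibleSchedule I S × RespectsBounds I B S)

LowestFirst : (I : Instance) → Schedule I → Set
LowestFirst I S = ∀ i i' t → toℕ i < toℕ i' → S i t ≡ nothing → S i' t ≡ nothing

-- PLTR (relational semantics of the deterministic algorithm)

inRange : ℕ → ℕ → ℕ → Bool
inRange a b s = (a ≤ᵇ s) ∧ (s <ᵇ b)

setUpper : ℕ → ℕ → ℕ → Bounds → Bounds
setUpper v a b (bounds l u) = bounds l (λ s → if inRange a b s then v else u s)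

raiseLower : ℕ → ℕ → ℕ → Bounds → Bounds
raiseLower k a b (bounds l u) = bounds (λ s → if inRange a b s then k ⊔ l s else l s) u

IsMaximal : (I : Instance) → (ℕ → Bounds) → ℕ → ℕ → Set
IsMaximal I upd t t' =
  t ≤ t' × t' ≤ suc (lastSlot I) × FeasibleB I (upd t') ×
  (∀ t'' → t' < t'' → t'' ≤ suc (lastSlot I) → ¬ FeasibleB I (upd t''))

-- KeepIdle(k,t): B ↦ B' returning t'   (k = suc k', so k-1 = k')
KeepIdle : (I : Instance) → ℕ → ℕ → Bounds → ℕ → Bounds → Set
KeepIdle I k' t B t' B' = IsMaximal I (λ s → setUpper k' t s B) t t' × B' ≡ setUpper k' t t' B

KeepBusy : (I : Instance) → ℕ → ℕ → Bounds → ℕ → Bounds → Set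
KeepBusy I k t B t' B' = IsMaximal I (λ s → raiseLower k t s B) t t' × B' ≡ raiseLower k t t' B

-- inner while loop for k = suc k', starting at slot t with bounds B, ending with bounds B'
data InnerLoop (I : Instance) (k' : ℕ) : ℕ → Bounds → Bounds → Set where
  exit : ∀ {t B} → lastSlot I < t → InnerLoop I k' t B B
  step : ∀ {t t₁ t₂ B B₁ B₂ B'} → t ≤ lastSlot I →
         KeepIdle I k' t B t₁ B₁ → KeepBusy I (suc k') t₁ B₁ t₂ B₂ →
         InnerLoop I k' t₂ B₂ B' → InnerLoop I k' t B B'

-- outer for loop k = K, K-1, ..., 1
data OuterLoop (I : Instance) : ℕ → Bounds → Bounds → Set where
  done : ∀ {B} → OuterLoop I zero B B
  next : ∀ {k' B B₁ B'} → InnerLoop I k' 0 B B₁ → OuterLoop I k' B₁ B' →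
         OuterLoop I (suc k') B B'

initialBounds : Instance → Bounds
initialBounds I = bounds (λ _ → 0) (λ _ → Instance.m I)

PLTRRun : (I : Instance) → Bounds → Set
PLTRRun I B = OuterLoop I (Instance.m I) (initialBounds I) B

PLTROutput : (I : Instance) → Bounds → Schedule I → Set
PLTROutput I B S = FeasibleSchedule I S × RespectsBounds I B S × LowestFirst I S

{-# OPTIONS --safe #-}
-- Every KeepIdle/KeepBusy call picks its endpoint among bounds that keep the instance
-- feasible, and the empty update is such an endpoint, so all bounds produced by PLTR stay
-- feasible. Each round of the inner loop advances by at least one slot: if m_t cannot be
-- lowered to k-1, then every feasible schedule keeps at least k processors busy at t, so
-- l_t can be raised to k. Finally, a feasible schedule is determined, up to the choice of
-- processors, by its finite job/slot incidence pattern; packing the pattern of a schedule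
-- for the final bounds onto the lowest-numbered processors gives PLTR's output. The same
-- finiteness lets exhaustive search over patterns replace the flow computation.
module Submission where

open import Defs
open import Data.Nat
  using (ℕ; zero; suc; _+_; _≤_; _<_; _⊔_; _≤ᵇ_; _<ᵇ_; _≤?_; _<?_; z≤n; s≤s; s≤s⁻¹)
open import Data.Nat.Properties
  using ( +-0-commutativeMonoid; +-mono-≤; +-monoˡ-≤; +-identityʳ; +-suc; allUpTo?
        ; ≤-refl; ≤-trans; ≤-antisym; <⇒≤; <-irrefl; <-≤-trans; ≤-<-trans; ≤∧≢⇒<
        ; <⇒≱; m≤n⇒m≤1+n; m≤n⇒m<n∨m≡n; ≮⇒≥; ≰⇒>; ≤ᵇ⇒≤; <ᵇ⇒<; ⊔-lub)
import Data.Nat as ℕ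
open import Data.Nat.ListAction using (sum)
open import Data.Bool using (Bool; true; false; T; if_then_else_)
open import Data.Bool.Properties using (⇔→≡)
open import Data.Bool.ListAction using (any)
open import Data.Fin using (Fin; toℕ) renaming (zero to fzero; suc to fsuc)
open import Data.Fin.Properties using (suc-injective; 0≢1+n; all?; toℕ<n)
open import Data.Fin.Subset using (Subset)
open import Data.Fin.Subset.Properties using (anySubset?)
open import Data.List using (List; []; _∷_; length; filter; map; tabulate; allFin; applyUpTo; upTo)
open import Data.List.Properties using (map-upTo)
open import Data.List.Membership.Propositional using (_∈_)
open import Data.List.Membership.Propositional.Properties using (∈-filter⁺; ∈-filter⁻; ∈-allFin)
open import Data.List.Relation.Unary.Any using (here; there)
open import Data.List.Relation.Unary.Any.Properties using (any⁺; any⁻; tabulate⁺; tabulate⁻)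
import Data.List.Relation.Unary.All as All
open import Data.List.Relation.Unary.Unique.Propositional using (Unique; _∷_)
open import Data.List.Relation.Unary.Unique.Propositional.Properties using (filter⁺; allFin⁺)
open import Data.Vec using (Vec; []; _∷_; lookup) renaming (tabulate to tabulateᵛ)
open import Data.Vec.Properties using (lookup∘tabulate)
open import Data.Maybe using (Maybe; just; nothing; is-just)
open import Data.Maybe.Properties using (just-injective)
open import Data.Product using (Σ; ∃; _×_; _,_; proj₁; proj₂; uncurry)
import Data.Product as Product
open import Data.Sum using (_⊎_; inj₁; inj₂)
open import Data.Empty using (⊥-elim)
open import Function using (_∘_; id; _⇔_; mk⇔; Equivalence)
open import Relation.Binary.PropositionalEquality
open import Relation.Nullary using (¬_; Dec; yes; no)
open import Relation.Nullary.Decidable using (T?; _×-dec_; _→-dec_; map′; toWitness; fromWitness)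
open import Relation.Unary using (Decidable)
open import Algebra.Properties.CommutativeMonoid.Sum +-0-commutativeMonoid
  using (sum-syntax; sum-cong-≗; sum-replicate-zero; ∑-comm) renaming (sum to ∑)

private variable
  A : Set
  k : ℕ
  x : A
  xs : List A

≡true⇒T : ∀ {b} → b ≡ true → T b
≡true⇒T refl = _

T⇒≡true : ∀ {b} → T b → b ≡ true
T⇒≡true {true} _ = refl

T-ext : ∀ {a b} → (T a → T b) → (T b → T a) → a ≡ b
T-ext a⇒b b⇒a = ⇔→≡ (mk⇔ (T⇒≡true ∘ a⇒b ∘ ≡true⇒T) (T⇒≡true ∘ b⇒a ∘ ≡true⇒T))

sum-map-tabulate : (g : A → ℕ) (f : Fin k → A) → sum (map g (tabulate f)) ≡ ∑ (g ∘ f)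
sum-map-tabulate {k = zero}  g f = refl
sum-map-tabulate {k = suc k} g f = cong (g (f fzero) +_) (sum-map-tabulate g (f ∘ fsuc))

sum-applyUpTo : (g : ℕ → ℕ) (k : ℕ) → sum (applyUpTo g k) ≡ ∑[ i < k ] g (toℕ i)
sum-applyUpTo g zero    = refl
sum-applyUpTo g (suc k) = cong (g 0 +_) (sum-applyUpTo (g ∘ suc) k)

sum-map-upTo : (g : ℕ → ℕ) (k : ℕ) → sum (map g (upTo k)) ≡ ∑[ i < k ] g (toℕ i)
sum-map-upTo g k = trans (cong sum (map-upTo g k)) (sum-applyUpTo g k)

any-tabulate⁺ : (q : A → Bool) {f : Fin k → A} (i : Fin k) → T (q (f i)) → T (any q (tabulate f))
any-tabulate⁺ q i = any⁺ q ∘ tabulate⁺ i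

any-tabulate⁻ : (q : A → Bool) {f : Fin k → A} → T (any q (tabulate f)) → ∃ λ i → T (q (f i))
any-tabulate⁻ q = tabulate⁻ ∘ any⁻ q _

b2n≤1 : ∀ b → b2n b ≤ 1
b2n≤1 true  = s≤s z≤n
b2n≤1 false = z≤n

∑-b2n≤ : (p : Fin k → Bool) → ∑ (b2n ∘ p) ≤ k
∑-b2n≤ {k = zero}  p = z≤n
∑-b2n≤ {k = suc k} p = +-mono-≤ (b2n≤1 (p fzero)) (∑-b2n≤ (p ∘ fsuc))

∑-b2n-atMostOne : (q : A → Bool) (f : Fin k → A) →
  (∀ i i' → T (q (f i)) → T (q (f i')) → i ≡ i') →
  ∑ (b2n ∘ q ∘ f) ≡ b2n (any q (tabulate f))
∑-b2n-atMostOne {k = zero}  q f atMostOne = refl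
∑-b2n-atMostOne {k = suc k} q f atMostOne
  rewrite ∑-b2n-atMostOne q (f ∘ fsuc) (λ i i' p p' → suc-injective (atMostOne _ _ p p'))
  with q (f fzero) in head | any q (tabulate (f ∘ fsuc)) in rest
... | false | _     = refl
... | true  | false = refl
... | true  | true  =
  let (i , p) = any-tabulate⁻ q (≡true⇒T rest)
  in  ⊥-elim (0≢1+n (atMostOne fzero (fsuc i) (≡true⇒T head) p))

isJob-sound : ∀ {n} {j : Fin n} mb → T (isJob j mb) → mb ≡ just j
isJob-sound (just j') p = cong just (sym (toWitness p))

isJob-refl : ∀ {n} (j : Fin n) → T (isJob j (just j))
isJob-refl j = fromWitness refl

∑-isJob : ∀ {n} (mb : Maybe (Fin n)) → ∑[ j < n ] b2n (isJob j mb) ≡ b2n (is-just mb)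
∑-isJob {n} nothing   = sum-replicate-zero n
∑-isJob     (just j₀) = trans
  (∑-b2n-atMostOne (λ j → isJob j (just j₀)) id
    (λ i i' p p' → just-injective (trans (sym (isJob-sound _ p)) (isJob-sound _ p'))))
  (cong b2n (T⇒≡true (any-tabulate⁺ (λ j → isJob j (just j₀)) j₀ (isJob-refl j₀))))

module _ (I : Instance) (S : Schedule I) where
  open Instance I

  occupied⁻ : ∀ {j t} → T (occupied I S j t) → ∃ λ i → S i t ≡ just j
  occupied⁻ p = Product.map₂ (isJob-sound _) (any-tabulate⁻ _ p)

  occupied⁺ : ∀ {i j t} → S i t ≡ just j → T (occupied I S j t)
  occupied⁺ {i} {j} e = any-tabulate⁺ _ i (subst (T ∘ isJob j) (sym e) (isJob-refl j))

  volume≤m : ∀ t → volume I S t ≤ m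
  volume≤m t = subst (_≤ m) (sym (sum-map-tabulate (λ i → b2n (is-just (S i t))) id))
                 (∑-b2n≤ (λ i → is-just (S i t)))

  volume≡∑-occupied : (∀ i i' t j → S i t ≡ just j → S i' t ≡ just j → i ≡ i') →
    ∀ t → volume I S t ≡ ∑[ j < n ] b2n (occupied I S j t)
  volume≡∑-occupied noParallel t = begin
    volume I S t                                 ≡⟨ sum-map-tabulate (λ i → b2n (is-just (S i t))) id ⟩
    ∑[ i < m ] b2n (is-just (S i t))             ≡⟨ sum-cong-≗ (sym ∘ ∑-isJob ∘ λ i → S i t) ⟩
    ∑[ i < m ] ∑[ j < n ] b2n (isJob j (S i t))  ≡⟨ ∑-comm (λ i j → b2n (isJob j (S i t))) ⟩
    ∑[ j < n ] ∑[ i < m ] b2n (isJob j (S i t))  ≡⟨ sum-cong-≗ (λ j → ∑-b2n-atMostOne _ id (onOneProcessor j)) ⟩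
    ∑[ j < n ] b2n (occupied I S j t)            ∎
    where
    open ≡-Reasoning
    onOneProcessor : ∀ j i i' → T (isJob j (S i t)) → T (isJob j (S i' t)) → i ≡ i'
    onOneProcessor j i i' p p' = noParallel i i' t j (isJob-sound _ p) (isJob-sound _ p')

packAt : List A → Fin k → Maybe A
packAt []       i        = nothing
packAt (x ∷ xs) fzero    = just x
packAt (x ∷ xs) (fsuc i) = packAt xs i

packAt-∈ : ∀ {i : Fin k} → packAt xs i ≡ just x → x ∈ xs
packAt-∈ {xs = x ∷ xs} {i = fzero}  refl = here refl
packAt-∈ {xs = x ∷ xs} {i = fsuc i} e    = there (packAt-∈ e)

packAt-complete : length xs ≤ k → x ∈ xs → ∃ λ (i : Fin k) → packAt xs i ≡ just x
packAt-complete (s≤s _) (here refl)  = fzero , refl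
packAt-complete (s≤s l) (there x∈xs) = Product.map fsuc id (packAt-complete l x∈xs)

packAt-injective : Unique xs → ∀ {i i' : Fin k} → packAt xs i ≡ just x → packAt xs i' ≡ just x → i ≡ i'
packAt-injective {xs = x ∷ xs} (x∉xs ∷ u) {i = fzero}  {fzero}   e    e'   = refl
packAt-injective {xs = x ∷ xs} (x∉xs ∷ u) {i = fzero}  {fsuc i'} refl e'   =
  ⊥-elim (All.lookup x∉xs (packAt-∈ e') refl)
packAt-injective {xs = x ∷ xs} (x∉xs ∷ u) {i = fsuc i} {fzero}   e    refl =
  ⊥-elim (All.lookup x∉xs (packAt-∈ e) refl)
packAt-injective {xs = x ∷ xs} (x∉xs ∷ u) {i = fsuc i} {fsuc i'} e    e'   = cong fsuc (packAt-injective u e e')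

∑-packAt : (xs : List A) → length xs ≤ k → ∑ (b2n ∘ is-just ∘ packAt {k = k} xs) ≡ length xs
∑-packAt {k = k}     []       _       = sum-replicate-zero k
∑-packAt {k = suc k} (x ∷ xs) (s≤s l) = cong suc (∑-packAt xs l)

packAt-nothing : ∀ {i : Fin k} → packAt xs i ≡ nothing → length xs ≤ toℕ i
packAt-nothing {xs = []}                    e = z≤n
packAt-nothing {xs = x ∷ xs} {i = fsuc i} e = s≤s (packAt-nothing {xs = xs} e)

packAt-beyond : ∀ {i : Fin k} → length xs ≤ toℕ i → packAt xs i ≡ nothing
packAt-beyond {xs = []}                    l       = refl
packAt-beyond {xs = x ∷ xs} {i = fsuc i} (s≤s l) = packAt-beyond {xs = xs} l

packAt-lowestFirst : (xs : List A) {i i' : Fin k} →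
  toℕ i < toℕ i' → packAt xs i ≡ nothing → packAt xs i' ≡ nothing
packAt-lowestFirst xs i<i' e = packAt-beyond {xs = xs} (≤-trans (packAt-nothing {xs = xs} e) (<⇒≤ i<i'))

length-filter-tabulate : (q : A → Bool) (f : Fin k → A) →
  length (filter (T? ∘ q) (tabulate f)) ≡ ∑ (b2n ∘ q ∘ f)
length-filter-tabulate {k = zero}  q f = refl
length-filter-tabulate {k = suc k} q f with q (f fzero)
... | true  = cong suc (length-filter-tabulate q (f ∘ fsuc))
... | false = length-filter-tabulate q (f ∘ fsuc)

Searchable : Set → Set₁
Searchable A = ∀ {P : A → Set} → Decidable P → Dec (∃ P)

searchVec : Searchable A → ∀ k → Searchable (Vec A k)
searchVec search zero    P? = map′ ([] ,_) (λ { ([] , p) → p }) (P? [])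
searchVec search (suc k) P? = map′ (λ (x , xs , p) → x ∷ xs , p) (λ { (x ∷ xs , p) → x , xs , p })
  (search (λ x → searchVec search k (P? ∘ (x ∷_))))

at : Vec Bool k → ℕ → Bool
at []      t       = false
at (b ∷ v) zero    = b
at (b ∷ v) (suc t) = at v t

at-bound : (v : Vec Bool k) {t : ℕ} → T (at v t) → t < k
at-bound (b ∷ v) {zero}  p = s≤s z≤n
at-bound (b ∷ v) {suc t} p = s≤s (at-bound v p)

at-tabulate : (h : ℕ → Bool) {t : ℕ} → t < k → at (tabulateᵛ {n = k} (h ∘ toℕ)) t ≡ h t
at-tabulate h {zero}  (s≤s _)   = refl
at-tabulate h {suc t} (s≤s t<k) = at-tabulate (h ∘ suc) t<k

module _ (I : Instance) where
  open Instance I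

  horizon : ℕ
  horizon = suc (lastSlot I)

  -- row j is the set of slots in which job j runs
  Pattern : Set
  Pattern = Vec (Subset horizon) n

  active : Pattern → Fin n → ℕ → Bool
  active X j = at (lookup X j)

  jobsAt : Pattern → ℕ → List (Fin n)
  jobsAt X t = filter (T? ∘ λ j → active X j t) (allFin n)

  load : Pattern → ℕ → ℕ
  load X t = ∑[ j < n ] b2n (active X j t)

  record Admissible (B : Bounds) (X : Pattern) : Set where
    field
      window   : ∀ j {t} → t < horizon → T (active X j t) → Job.rel (job j) ≤ t × t ≤ Job.dl (job j)
      amount   : ∀ j → ∑[ s < horizon ] b2n (active X j (toℕ s)) ≡ Job.vol (job j)
      bounded  : ∀ {t} → t < horizon → Bounds.lower B t ≤ load X t × load X t ≤ Bounds.upper B t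
      capacity : ∀ {t} → t < horizon → load X t ≤ m

  admissible? : (B : Bounds) → Decidable (Admissible B)
  admissible? B X = map′ fromConditions toConditions
    (all? (λ j → allUpTo? (λ t → T? (active X j t) →-dec (_ ≤? t ×-dec t ≤? _)) horizon) ×-dec
     all? (λ j → _ ℕ.≟ _) ×-dec
     allUpTo? (λ t → _ ≤? load X t ×-dec load X t ≤? _) horizon ×-dec
     allUpTo? (λ t → load X t ≤? m) horizon)
    where
    Conditions : Set
    Conditions =
      (∀ j {t} → t < horizon → T (active X j t) → Job.rel (job j) ≤ t × t ≤ Job.dl (job j)) ×
      (∀ j → ∑[ s < horizon ] b2n (active X j (toℕ s)) ≡ Job.vol (job j)) ×
      (∀ {t} → t < horizon → Bounds.lower B t ≤ load X t × load X t ≤ Bounds.upper B t) ×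
      (∀ {t} → t < horizon → load X t ≤ m)
    fromConditions : Conditions → Admissible B X
    fromConditions (w , a , b , c) = record { window = w ; amount = a ; bounded = b ; capacity = c }
    toConditions : Admissible B X → Conditions
    toConditions adm = window , amount , bounded , capacity
      where open Admissible adm

  pack : Pattern → Schedule I
  pack X i t = packAt (jobsAt X t) i

  patternOf : Schedule I → Pattern
  patternOf S = tabulateᵛ λ j → tabulateᵛ λ s → occupied I S j (toℕ s)

  module _ (X : Pattern) {t : ℕ} where

    length-jobsAt : length (jobsAt X t) ≡ load X t
    length-jobsAt = length-filter-tabulate (λ j → active X j t) id

    unique-jobsAt : Unique (jobsAt X t)
    unique-jobsAt = filter⁺ _ (allFin⁺ n)

    ∈-jobsAt : ∀ {j} → j ∈ jobsAt X t ⇔ T (active X j t)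
    ∈-jobsAt {j} = mk⇔ (proj₂ ∘ ∈-filter⁻ isActive? {xs = allFin n})
                       (∈-filter⁺ isActive? (∈-allFin j))
      where
      isActive? : Decidable (λ j → T (active X j t))
      isActive? j = T? (active X j t)

    occupied-pack : load X t ≤ m → ∀ j → occupied I (pack X) j t ≡ active X j t
    occupied-pack ≤m j = T-ext occupied⇒active active⇒occupied
      where
      open Equivalence
      occupied⇒active : T (occupied I (pack X) j t) → T (active X j t)
      occupied⇒active occ = to ∈-jobsAt (packAt-∈ (proj₂ (occupied⁻ I (pack X) occ)))
      active⇒occupied : T (active X j t) → T (occupied I (pack X) j t)
      active⇒occupied act = occupied⁺ I (pack X) (proj₂ (packAt-complete {xs = jobsAt X t}
        (subst (_≤ m) (sym length-jobsAt) ≤m) (from ∈-jobsAt act)))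

    volume-pack : load X t ≤ m → volume I (pack X) t ≡ load X t
    volume-pack ≤m = begin
      volume I (pack X) t                    ≡⟨ sum-map-tabulate (b2n ∘ is-just ∘ λ i → pack X i t) id ⟩
      ∑[ i < m ] b2n (is-just (pack X i t))  ≡⟨ ∑-packAt (jobsAt X t) (subst (_≤ m) (sym length-jobsAt) ≤m) ⟩
      length (jobsAt X t)                    ≡⟨ length-jobsAt ⟩
      load X t                               ∎
      where open ≡-Reasoning

  pack-output : ∀ {B X} → Admissible B X → PLTROutput I B (pack X)
  pack-output {B} {X} adm = feasible , respects , λ i i' t → packAt-lowestFirst (jobsAt X t)
    where
    open Admissible adm
    feasible : FeasibleSchedule I (pack X)
    feasible .FeasibleSchedule.inWindow i t j e =
      let act = Equivalence.to (∈-jobsAt X) (packAt-∈ e) in window j (at-bound (lookup X j) act) act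
    feasible .FeasibleSchedule.noParallel i i' t j = packAt-injective (unique-jobsAt X)
    feasible .FeasibleSchedule.volumeOK j = begin
      slotsOf I (pack X) j                                  ≡⟨ sum-map-upTo _ horizon ⟩
      ∑[ s < horizon ] b2n (occupied I (pack X) j (toℕ s))  ≡⟨ sum-cong-≗ (cong b2n ∘ packed) ⟩
      ∑[ s < horizon ] b2n (active X j (toℕ s))             ≡⟨ amount j ⟩
      Job.vol (job j)                                       ∎
      where
      open ≡-Reasoning
      packed : ∀ s → occupied I (pack X) j (toℕ s) ≡ active X j (toℕ s)
      packed s = occupied-pack X (capacity (toℕ<n s)) j
    respects : RespectsBounds I B (pack X)
    respects t t≤d rewrite volume-pack X (capacity (s≤s t≤d)) = bounded (s≤s t≤d)

  patternOf-admissible : ∀ {B S} → FeasibleSchedule I S → RespectsBounds I B S → Admissible B (patternOf S)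
  patternOf-admissible {B} {S} feasible respects = record
    { window   = λ j t<h act →
        let (i , e) = occupied⁻ I S (subst T (active-patternOf j t<h) act) in inWindow i _ j e
    ; amount   = λ j → begin
        ∑[ s < horizon ] b2n (active X j (toℕ s))     ≡⟨ sum-cong-≗ (λ s → cong b2n (active-patternOf j (toℕ<n s))) ⟩
        ∑[ s < horizon ] b2n (occupied I S j (toℕ s))  ≡⟨ sum-map-upTo _ horizon ⟨
        slotsOf I S j                                ≡⟨ volumeOK j ⟩
        Job.vol (job j)                              ∎
    ; bounded  = λ t<h → subst (λ v → Bounds.lower B _ ≤ v × v ≤ Bounds.upper B _)
                           (sym (load-patternOf t<h)) (respects _ (s≤s⁻¹ t<h))
    ; capacity = λ {t} t<h → subst (_≤ m) (sym (load-patternOf t<h)) (volume≤m I S t)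
    }
    where
    open FeasibleSchedule feasible
    open ≡-Reasoning
    X = patternOf S
    active-patternOf : ∀ j {t} → t < horizon → active X j t ≡ occupied I S j t
    active-patternOf j t<h =
      trans (cong (λ row → at row _) (lookup∘tabulate _ j)) (at-tabulate (occupied I S j) t<h)
    load-patternOf : ∀ {t} → t < horizon → load X t ≡ volume I S t
    load-patternOf {t} t<h = trans (sum-cong-≗ {n} (λ j → cong b2n (active-patternOf j t<h)))
                                   (sym (volume≡∑-occupied I S noParallel t))

  feasibleB? : (B : Bounds) → Dec (FeasibleB I B)
  feasibleB? B = map′
    (λ (X , adm) → pack X , proj₁ (pack-output adm) , proj₁ (proj₂ (pack-output adm)))
    (λ (S , feasible , respects) → patternOf S , patternOf-admissible feasible respects)
    (searchVec anySubset? n (admissible? B))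

  normalise : ∀ {B} → FeasibleB I B → Σ (Schedule I) (PLTROutput I B)
  normalise (S , feasible , respects) = pack (patternOf S) , pack-output (patternOf-admissible feasible respects)

Maximal : (P : ℕ → Set) (t N t' : ℕ) → Set
Maximal P t N t' = t ≤ t' × t' ≤ N × P t' × (∀ t'' → t' < t'' → t'' ≤ N → ¬ P t'')

maximal : ∀ {P : ℕ → Set} → Decidable P → ∀ {t} N → t ≤ N → P t → ∃ (Maximal P t N)
maximal {P} P? zero z≤n pt = 0 , z≤n , z≤n , pt , λ t'' 0<t'' t''≤0 → ⊥-elim (<⇒≱ 0<t'' t''≤0)
maximal {P} P? (suc N) t≤N pt with P? (suc N)
... | yes pN = suc N , t≤N , ≤-refl , pN , λ t'' N<t'' t''≤N → ⊥-elim (<⇒≱ N<t'' t''≤N)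
... | no ¬pN with maximal P? N (s≤s⁻¹ (≤∧≢⇒< t≤N λ { refl → ¬pN pt })) pt
...   | t' , t≤t' , t'≤N , pt' , above =
  t' , t≤t' , m≤n⇒m≤1+n t'≤N , pt' ,
  λ t'' t'<t'' t''≤N → aboveOrTop t'' t'<t'' (m≤n⇒m<n∨m≡n t''≤N)
  where
  aboveOrTop : ∀ t'' → t' < t'' → t'' < suc N ⊎ t'' ≡ suc N → ¬ P t''
  aboveOrTop t'' t'<t'' (inj₁ t''<N) = above t'' t'<t'' (s≤s⁻¹ t''<N)
  aboveOrTop t'' t'<t'' (inj₂ refl)  = ¬pN

maximal-upperBound : ∀ {P t N t'} → Maximal P t N t' → ∀ {s} → s ≤ N → P s → s ≤ t'
maximal-upperBound {t' = t'} (_ , _ , _ , above) {s} s≤N ps with t' <? s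
... | yes t'<s = ⊥-elim (above s t'<s s≤N ps)
... | no  t'≮s = ≮⇒≥ t'≮s

inRange-sound : ∀ a b s → T (inRange a b s) → a ≤ s × s < b
inRange-sound a b s p with a ≤ᵇ s in a≤s | s <ᵇ b in s<b
... | true | true = ≤ᵇ⇒≤ a s (≡true⇒T a≤s) , <ᵇ⇒< s b (≡true⇒T s<b)

inRange-empty : ∀ a s → inRange a a s ≡ false
inRange-empty a s with inRange a a s in e
... | false = refl
... | true  = ⊥-elim (<-irrefl refl (uncurry ≤-<-trans (inRange-sound a a s (≡true⇒T e))))

inRange-singleton : ∀ a s → T (inRange a (suc a) s) → s ≡ a
inRange-singleton a s p = let (a≤s , s<1+a) = inRange-sound a (suc a) s p in ≤-antisym (s≤s⁻¹ s<1+a) a≤s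

module _ (I : Instance) where

  private
    d : ℕ
    d = lastSlot I

  FeasibleB-cong : ∀ {B B'} → Bounds.lower B' ≗ Bounds.lower B → Bounds.upper B' ≗ Bounds.upper B →
                   FeasibleB I B → FeasibleB I B'
  FeasibleB-cong lower≡ upper≡ (S , feasible , respects) = S , feasible , λ t t≤d →
    Product.map (subst (_≤ _) (sym (lower≡ t))) (subst (_ ≤_) (sym (upper≡ t))) (respects t t≤d)

  setUpper-empty : ∀ v t B s → Bounds.upper (setUpper v t t B) s ≡ Bounds.upper B s
  setUpper-empty v t B s = cong (if_then v else Bounds.upper B s) (inRange-empty t s)

  raiseLower-empty : ∀ k t B s → Bounds.lower (raiseLower k t t B) s ≡ Bounds.lower B s
  raiseLower-empty k t B s = cong (if_then k ⊔ Bounds.lower B s else Bounds.lower B s) (inRange-empty t s)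

  idle-or-busy : ∀ k' t {B} → FeasibleB I B →
    FeasibleB I (setUpper k' t (suc t) B) ⊎ FeasibleB I (raiseLower (suc k') t (suc t) B)
  idle-or-busy k' t {B} (S , feasible , respects) with volume I S t ≤? k'
  ... | yes idle = inj₁ (S , feasible , respects-idle)
    where
    respects-idle : RespectsBounds I (setUpper k' t (suc t) B) S
    respects-idle s s≤d with inRange t (suc t) s in e
    ... | true  rewrite inRange-singleton t s (≡true⇒T e) = Product.map₂ (λ _ → idle) (respects t s≤d)
    ... | false = respects s s≤d
  ... | no busy = inj₂ (S , feasible , respects-busy)
    where
    respects-busy : RespectsBounds I (raiseLower (suc k') t (suc t) B) S
    respects-busy s s≤d with inRange t (suc t) s in e
    ... | true  rewrite inRange-singleton t s (≡true⇒T e) =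
      Product.map₁ (⊔-lub (≰⇒> busy)) (respects t s≤d)
    ... | false = respects s s≤d

  record Round (k' t : ℕ) (B : Bounds) : Set where
    field
      {t₁ t₂}  : ℕ
      {B₁ B₂}  : Bounds
      keepIdle : KeepIdle I k' t B t₁ B₁
      keepBusy : KeepBusy I (suc k') t₁ B₁ t₂ B₂
      feasible : FeasibleB I B₂
      advances : t < t₂

  round : ∀ k' {t B} → t ≤ d → FeasibleB I B → Round k' t B
  round k' {t} {B} t≤d fB
    with maximal (feasibleB? I ∘ λ s → setUpper k' t s B) (suc d) (m≤n⇒m≤1+n t≤d)
                 (FeasibleB-cong (λ _ → refl) (setUpper-empty k' t B) fB)
  ... | t₁ , idle@(t≤t₁ , t₁≤1+d , fB₁ , _)
    with maximal (feasibleB? I ∘ λ s → raiseLower (suc k') t₁ s (setUpper k' t t₁ B)) (suc d) t₁≤1+d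
                 (FeasibleB-cong (raiseLower-empty (suc k') t₁ (setUpper k' t t₁ B)) (λ _ → refl) fB₁)
  ... | t₂ , busy@(t₁≤t₂ , _ , fB₂ , _) = record
    { keepIdle = idle , refl ; keepBusy = busy , refl ; feasible = fB₂ ; advances = advances }
    where
    -- if KeepIdle is stuck at t, no feasible schedule is idle enough at t, so KeepBusy passes t
    advances : t < t₂
    advances with t <? t₁
    ... | yes t<t₁ = <-≤-trans t<t₁ t₁≤t₂
    ... | no  t≮t₁ with ≤-antisym t≤t₁ (≮⇒≥ t≮t₁) | idle-or-busy k' t fB
    ...   | refl | inj₁ idle-at-t = ⊥-elim (t≮t₁ (maximal-upperBound idle (s≤s t≤d) idle-at-t))
    ...   | refl | inj₂ busy-at-t = maximal-upperBound busy (s≤s t≤d)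
                                      (FeasibleB-cong (λ _ → refl) (setUpper-empty k' t B) busy-at-t)

  Reaches : (Bounds → Bounds → Set) → Bounds → Set
  Reaches Loop B = ∃ λ B' → Loop B B' × FeasibleB I B'

  -- every round advances t, so the fuel never runs out before t passes the last slot
  innerLoop : ∀ k' fuel {t B} → suc d ≤ t + fuel → FeasibleB I B → Reaches (InnerLoop I k' t) B
  innerLoop k' fuel {t} enough fB with d <? t
  ... | yes d<t = _ , exit d<t , fB
  innerLoop k' zero       {t} enough fB | no d≮t = ⊥-elim (d≮t (subst (suc d ≤_) (+-identityʳ t) enough))
  innerLoop k' (suc fuel) {t} enough fB | no d≮t
    with round k' (≮⇒≥ d≮t) fB
  ... | record { keepIdle = keepIdle ; keepBusy = keepBusy ; feasible = fB₂ ; advances = advances }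
    with innerLoop k' fuel (≤-trans (subst (suc d ≤_) (+-suc t fuel) enough) (+-monoˡ-≤ fuel advances)) fB₂
  ... | B' , loop , fB' = B' , step (≮⇒≥ d≮t) keepIdle keepBusy loop , fB'

  outerLoop : ∀ k {B} → FeasibleB I B → Reaches (OuterLoop I k) B
  outerLoop zero     fB = _ , done , fB
  outerLoop (suc k') fB with innerLoop k' (suc d) ≤-refl fB
  ... | B₁ , inner , fB₁ with outerLoop k' fB₁
  ... | B' , outer , fB' = B' , next inner outer , fB'

theorem1 : (I : Instance) → Feasible I →
    Σ Bounds (λ B → PLTRRun I B × Σ (Schedule I) (λ S → PLTROutput I B S))
theorem1 I (S , feasible) with outerLoop I (Instance.m I) (S , feasible , λ t _ → z≤n , volume≤m I S t)
... | B , run , fB = B , run , normalise I fB
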